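{- Let $\mathbf A=(A;\wedge,d)$ be a finite regular SMB algebra and $a,b\in A$. Then the principal congruence $\mathrm{Cg}^{\mathbf A}(a,b)$ equals $D_{\{a,b\}}\circ D_{\{a,b\}}\circ D_{\{a,b\}}$, where $\circ$ is relational composition and $D_{\{a,b\}}$ is the subuniverse of $\mathbf A\times\mathbf A$ generated by $\{(a,b),(b,a)\}\cup\{(c,c):c\in A\}$.
   Context: An algebra $\mathbf A=(A;\wedge,d)$ is idempotent if $x\wedge x=x$ and $d(x,x,x)=x$ for all $x$. For a congruence ${\sim}$ of $\mathbf A$, $\mathbf A$ is an SMB algebra over ${\sim}$ if it is idempotent, $(A/{\sim};\wedge)$ is a semilattice, and on each ${\sim}$-class $\wedge$ acts as the second projection and $d$ acts as a Mal'cev operation ($d(x,y,y)=x=d(y,y,x)$). Write $[u]_{\sim}\le[v]_{\sim}$ iff $[u]_{\sim}\wedge[v]_{\sim}=[u]_{\sim}$. An SMB algebra over ${\sim}$ is regular if (i) $[d(a,b,c)]_{\sim}=[(a\wedge b)\wedge c]_{\sim}$ for all $a,b,c$; (ii) $a\wedge b=b$ whenever $[a]_{\sim}\ge[b]_{\sim}$; (iii) it satisfies $d(x,y,z)\approx d((y\wedge z)\wedge x,(x\wedge z)\wedge y,(x\wedge y)\wedge z)$; (iv) it satisfies $(x\wedge y)\wedge y\approx x\wedge y$. A regular SMB algebra is one that is regular over some congruence. -}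

module Defs where

open import Level using (0ℓ)
open import Data.Nat using (ℕ)
open import Data.Fin using (Fin)
open import Data.Product using (Σ; ∃; _×_; _,_)
open import Relation.Binary.PropositionalEquality using (_≡_)
open import Relation.Binary.Structures using (IsEquivalence)

Rel₀ : Set → Set₁
Rel₀ A = A → A → Set

_∘ᵣ_ : {A : Set} → Rel₀ A → Rel₀ A → Rel₀ A
(R ∘ᵣ S) x z = ∃ λ y → R x y × S y z

_≐_ : {A : Set} → Rel₀ A → Rel₀ A → Set
R ≐ S = ∀ x y → ((R x y → S x y) × (S x y → R x y))

module _ {A : Set} (_∧_ : A → A → A) (d : A → A → A → A) where

  record IsCongruence (_~_ : Rel₀ A) : Set where
    field
      equiv : IsEquivalence _~_
      ∧-cong : ∀ {x x' y y'} → x ~ x' → y ~ y' → (x ∧ y) ~ (x' ∧ y')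
      d-cong : ∀ {x x' y y' z z'} → x ~ x' → y ~ y' → z ~ z'
               → d x y z ~ d x' y' z'

  record IsRegularSMBOver (_~_ : Rel₀ A) : Set where
    field
      congruence : IsCongruence _~_
      ∧-idem : ∀ x → x ∧ x ≡ x
      d-idem : ∀ x → d x x x ≡ x
      -- (A/~ ; ∧) is a semilattice (idempotence is inherited from above)
      ∧-assoc/ : ∀ x y z → ((x ∧ y) ∧ z) ~ (x ∧ (y ∧ z))
      ∧-comm/ : ∀ x y → (x ∧ y) ~ (y ∧ x)
      ∧-proj₂ : ∀ x y → x ~ y → x ∧ y ≡ y
      d-malcevˡ : ∀ x y → x ~ y → d x y y ≡ x
      d-malcevʳ : ∀ x y → x ~ y → d y y x ≡ x
      -- regularity (i)–(iv); [b] ≤ [a] means [b] ∧ [a] = [b], i.e. (b ∧ a) ~ b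
      reg-i : ∀ a b c → d a b c ~ ((a ∧ b) ∧ c)
      reg-ii : ∀ a b → (b ∧ a) ~ b → a ∧ b ≡ b
      reg-iii : ∀ x y z → d x y z ≡ d ((y ∧ z) ∧ x) ((x ∧ z) ∧ y) ((x ∧ y) ∧ z)
      reg-iv : ∀ x y → (x ∧ y) ∧ y ≡ x ∧ y

  IsRegularSMB : Set₁
  IsRegularSMB = Σ (Rel₀ A) IsRegularSMBOver

  data D (a b : A) : Rel₀ A where
    D-ab   : D a b a b
    D-ba   : D a b b a
    D-diag : ∀ c → D a b c c
    D-∧    : ∀ {x₁ y₁ x₂ y₂} → D a b x₁ y₁ → D a b x₂ y₂
             → D a b (x₁ ∧ x₂) (y₁ ∧ y₂)
    D-d    : ∀ {x₁ y₁ x₂ y₂ x₃ y₃} → D a b x₁ y₁ → D a b x₂ y₂ → D a b x₃ y₃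
             → D a b (d x₁ x₂ x₃) (d y₁ y₂ y₃)

  data Cg (a b : A) : Rel₀ A where
    Cg-base  : Cg a b a b
    Cg-refl  : ∀ x → Cg a b x x
    Cg-sym   : ∀ {x y} → Cg a b x y → Cg a b y x
    Cg-trans : ∀ {x y z} → Cg a b x y → Cg a b y z → Cg a b x z
    Cg-∧     : ∀ {x₁ y₁ x₂ y₂} → Cg a b x₁ y₁ → Cg a b x₂ y₂
               → Cg a b (x₁ ∧ x₂) (y₁ ∧ y₂)
    Cg-d     : ∀ {x₁ y₁ x₂ y₂ x₃ y₃} → Cg a b x₁ y₁ → Cg a b x₂ y₂ → Cg a b x₃ y₃
               → Cg a b (d x₁ x₂ x₃) (d y₁ y₂ y₃)

-- Let x ⊑ y mean x ∧ y ~ x (the order of the semilattice A/~, pulled back to A) and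
-- c = a ∧ b. Every pair (x,z) of Cg(a,b) is either trivial or bridged by a path
-- x D x′ D z′ D z with x′ ⊑ x, z′ ⊑ z and x′ ~ z′ ~ c ∧ x ~ c ∧ z: the outer steps
-- only go down, the middle one stays inside a ~-class. The relation Θ of such pairs
-- contains (a,b) and is closed under ∧ and d coordinatewise. It is transitive because
-- D-steps can be glued inside a ~-class by the Mal'cev identities, and at a peak y
-- (both ends below y) by the regular identities d x y y = y ∧ x and d y y z = y ∧ z.
-- Hence Cg(a,b) = Θ ⊆ D ∘ D ∘ D.
module Submission where

open import Defs
open import Data.Nat using (ℕ)
open import Data.Fin using (Fin)
open import Data.Product using (_,_)
open import Data.Sum using (_⊎_; inj₁; inj₂)
open import Relation.Binary.PropositionalEquality as ≡ using (_≡_; refl; subst₂)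
open import Relation.Binary.Bundles using (Setoid)
open import Relation.Binary.Structures using (module IsEquivalence)
import Relation.Binary.Reasoning.Setoid

module RegularSMB {A : Set} {_∧_ : A → A → A} {d : A → A → A → A} {_~_ : Rel₀ A}
                  (R : IsRegularSMBOver _∧_ d _~_) where

  open IsRegularSMBOver R
  open IsCongruence congruence
  open IsEquivalence equiv using () renaming (refl to ~-refl; sym to ~-sym; trans to ~-trans)

  ~-setoid : Setoid _ _
  ~-setoid = record { Carrier = A ; _≈_ = _~_ ; isEquivalence = equiv }

  module ~-Reasoning = Relation.Binary.Reasoning.Setoid ~-setoid

  ≡⇒~ : ∀ {x y} → x ≡ y → x ~ y
  ≡⇒~ refl = ~-refl

  infix 4 _⊑_

  _⊑_ : Rel₀ A
  x ⊑ y = (x ∧ y) ~ x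

  ⊑-refl : ∀ x → x ⊑ x
  ⊑-refl x = ≡⇒~ (∧-idem x)

  ~⇒⊑ : ∀ {x y} → x ~ y → x ⊑ y
  ~⇒⊑ {x} {y} x~y = begin
    x ∧ y  ≈⟨ ∧-cong ~-refl x~y ⟨
    x ∧ x  ≡⟨ ∧-idem x ⟩
    x      ∎
    where open ~-Reasoning

  ⊑-trans : ∀ {x y z} → x ⊑ y → y ⊑ z → x ⊑ z
  ⊑-trans {x} {y} {z} x⊑y y⊑z = begin
    x ∧ z        ≈⟨ ∧-cong x⊑y ~-refl ⟨
    (x ∧ y) ∧ z  ≈⟨ ∧-assoc/ x y z ⟩
    x ∧ (y ∧ z)  ≈⟨ ∧-cong ~-refl y⊑z ⟩
    x ∧ y        ≈⟨ x⊑y ⟩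
    x            ∎
    where open ~-Reasoning

  ⊑-antisym : ∀ {x y} → x ⊑ y → y ⊑ x → x ~ y
  ⊑-antisym {x} {y} x⊑y y⊑x = begin
    x      ≈⟨ x⊑y ⟨
    x ∧ y  ≈⟨ ∧-comm/ x y ⟩
    y ∧ x  ≈⟨ y⊑x ⟩
    y      ∎
    where open ~-Reasoning

  x∧y⊑x : ∀ x y → x ∧ y ⊑ x
  x∧y⊑x x y = begin
    (x ∧ y) ∧ x  ≈⟨ ∧-assoc/ x y x ⟩
    x ∧ (y ∧ x)  ≈⟨ ∧-cong ~-refl (∧-comm/ y x) ⟩
    x ∧ (x ∧ y)  ≈⟨ ∧-assoc/ x x y ⟨
    (x ∧ x) ∧ y  ≡⟨ ≡.cong (_∧ y) (∧-idem x) ⟩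
    x ∧ y        ∎
    where open ~-Reasoning

  x∧y⊑y : ∀ x y → x ∧ y ⊑ y
  x∧y⊑y x y = ≡⇒~ (reg-iv x y)

  ∧-greatest : ∀ {x y z} → z ⊑ x → z ⊑ y → z ⊑ x ∧ y
  ∧-greatest {x} {y} {z} z⊑x z⊑y = begin
    z ∧ (x ∧ y)  ≈⟨ ∧-assoc/ z x y ⟨
    (z ∧ x) ∧ y  ≈⟨ ∧-cong z⊑x ~-refl ⟩
    z ∧ y        ≈⟨ z⊑y ⟩
    z            ∎
    where open ~-Reasoning

  ∧-mono-⊑ : ∀ {x x′ y y′} → x ⊑ x′ → y ⊑ y′ → x ∧ y ⊑ x′ ∧ y′
  ∧-mono-⊑ {x} {_} {y} x⊑x′ y⊑y′ =
    ∧-greatest (⊑-trans (x∧y⊑x x y) x⊑x′) (⊑-trans (x∧y⊑y x y) y⊑y′)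

  ∧-monoʳ-⊑ : ∀ c {x y} → x ⊑ y → c ∧ x ⊑ c ∧ y
  ∧-monoʳ-⊑ c = ∧-mono-⊑ (⊑-refl c)

  ∧-distribˡ-⊑ : ∀ c x y → c ∧ (x ∧ y) ⊑ (c ∧ x) ∧ (c ∧ y)
  ∧-distribˡ-⊑ c x y = ∧-greatest (∧-monoʳ-⊑ c (x∧y⊑x x y)) (∧-monoʳ-⊑ c (x∧y⊑y x y))

  ⊑⇒∧≡ : ∀ {x y} → y ⊑ x → x ∧ y ≡ y
  ⊑⇒∧≡ {x} {y} y⊑x = reg-ii x y y⊑x

  d~∧∧ : ∀ x y z → d x y z ~ ((x ∧ y) ∧ z)
  d~∧∧ = reg-i

  d-mono-⊑ : ∀ {x x′ y y′ z z′} → x ⊑ x′ → y ⊑ y′ → z ⊑ z′ → d x y z ⊑ d x′ y′ z′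
  d-mono-⊑ {x} {x′} {y} {y′} {z} {z′} x⊑x′ y⊑y′ z⊑z′ =
    ⊑-trans (~⇒⊑ (d~∧∧ x y z))
      (⊑-trans (∧-mono-⊑ (∧-mono-⊑ x⊑x′ y⊑y′) z⊑z′) (~⇒⊑ (~-sym (d~∧∧ x′ y′ z′))))

  d⊑₁ : ∀ x y z → d x y z ⊑ x
  d⊑₁ x y z = ⊑-trans (~⇒⊑ (d~∧∧ x y z)) (⊑-trans (x∧y⊑x _ z) (x∧y⊑x x y))

  d⊑₂ : ∀ x y z → d x y z ⊑ y
  d⊑₂ x y z = ⊑-trans (~⇒⊑ (d~∧∧ x y z)) (⊑-trans (x∧y⊑x _ z) (x∧y⊑y x y))

  d⊑₃ : ∀ x y z → d x y z ⊑ z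
  d⊑₃ x y z = ⊑-trans (~⇒⊑ (d~∧∧ x y z)) (x∧y⊑y _ z)

  ∧-distribˡ-d-⊑ : ∀ c x y z → c ∧ d x y z ⊑ d (c ∧ x) (c ∧ y) (c ∧ z)
  ∧-distribˡ-d-⊑ c x y z =
    ⊑-trans (∧-greatest (∧-greatest (∧-monoʳ-⊑ c (d⊑₁ x y z)) (∧-monoʳ-⊑ c (d⊑₂ x y z)))
                        (∧-monoʳ-⊑ c (d⊑₃ x y z)))
            (~⇒⊑ (~-sym (d~∧∧ (c ∧ x) (c ∧ y) (c ∧ z))))

  d-xyy≡y∧x : ∀ x y → d x y y ≡ y ∧ x
  d-xyy≡y∧x x y = begin
    d x y y                                        ≡⟨ reg-iii x y y ⟩
    d ((y ∧ y) ∧ x) ((x ∧ y) ∧ y) ((x ∧ y) ∧ y)   ≡⟨ ≡.cong₂ (λ u v → d (u ∧ x) v v) (∧-idem y) (reg-iv x y) ⟩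
    d (y ∧ x) (x ∧ y) (x ∧ y)                      ≡⟨ d-malcevˡ (y ∧ x) (x ∧ y) (∧-comm/ y x) ⟩
    y ∧ x                                          ∎
    where open ≡.≡-Reasoning

  d-yyz≡y∧z : ∀ y z → d y y z ≡ y ∧ z
  d-yyz≡y∧z y z = begin
    d y y z                                        ≡⟨ reg-iii y y z ⟩
    d ((y ∧ z) ∧ y) ((y ∧ z) ∧ y) ((y ∧ y) ∧ z)   ≡⟨ ≡.cong (λ u → d ((y ∧ z) ∧ y) ((y ∧ z) ∧ y) (u ∧ z)) (∧-idem y) ⟩
    d ((y ∧ z) ∧ y) ((y ∧ z) ∧ y) (y ∧ z)          ≡⟨ d-malcevʳ (y ∧ z) ((y ∧ z) ∧ y) (~-sym (x∧y⊑x y z)) ⟩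
    y ∧ z                                          ∎
    where open ≡.≡-Reasoning

  module Generated (a b : A) where

    Dab : Rel₀ A
    Dab = D _∧_ d a b

    D-sym : ∀ {x y} → Dab x y → Dab y x
    D-sym D-ab = D-ba
    D-sym D-ba = D-ab
    D-sym (D-diag u) = D-diag u
    D-sym (D-∧ p q) = D-∧ (D-sym p) (D-sym q)
    D-sym (D-d p q r) = D-d (D-sym p) (D-sym q) (D-sym r)

    D-trans-within-class : ∀ {x y z} → Dab x y → Dab y z → x ~ y → y ~ z → Dab x z
    D-trans-within-class {x} {y} {z} xDy yDz x~y y~z =
      subst₂ Dab (d-malcevˡ x y x~y) (d-malcevʳ z y (~-sym y~z)) (D-d xDy (D-diag y) yDz)

    D-trans-at-peak : ∀ {x y z} → Dab x y → Dab y z → x ⊑ y → z ⊑ y → Dab x z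
    D-trans-at-peak {x} {y} {z} xDy yDz x⊑y z⊑y =
      subst₂ Dab (≡.trans (d-xyy≡y∧x x y) (⊑⇒∧≡ x⊑y))
                 (≡.trans (d-yyz≡y∧z y z) (⊑⇒∧≡ z⊑y))
                 (D-d xDy (D-diag y) yDz)

    c : A
    c = a ∧ b

    record Bridge (x z : A) : Set where
      field
        x′ z′   : A
        x-D-x′  : Dab x x′
        x′-D-z′ : Dab x′ z′
        z′-D-z  : Dab z′ z
        x′~z′   : x′ ~ z′
        x′⊑x    : x′ ⊑ x
        z′⊑z    : z′ ⊑ z
        c∧x⊑x′  : c ∧ x ⊑ x′
        c∧z⊑z′  : c ∧ z ⊑ z′

    record LowBridge (x z : A) : Set where
      field
        bridge : Bridge x z
      open Bridge bridge public
      field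
        x′⊑c : x′ ⊑ c

    -- Diagonal pairs are added separately: their bridges need not reach down to c.
    Θ : Rel₀ A
    Θ x z = x ≡ z ⊎ LowBridge x z

    bridge-refl : ∀ x → Bridge x x
    bridge-refl x = record
      { x′ = x ; z′ = x ; x-D-x′ = D-diag x ; x′-D-z′ = D-diag x ; z′-D-z = D-diag x
      ; x′~z′ = ~-refl ; x′⊑x = ⊑-refl x ; z′⊑z = ⊑-refl x
      ; c∧x⊑x′ = x∧y⊑y c x ; c∧z⊑z′ = x∧y⊑y c x }

    bridge-sym : ∀ {x z} → Bridge x z → Bridge z x
    bridge-sym β = record
      { x′ = z′ ; z′ = x′ ; x-D-x′ = D-sym z′-D-z ; x′-D-z′ = D-sym x′-D-z′ ; z′-D-z = D-sym x-D-x′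
      ; x′~z′ = ~-sym x′~z′ ; x′⊑x = z′⊑z ; z′⊑z = x′⊑x ; c∧x⊑x′ = c∧z⊑z′ ; c∧z⊑z′ = c∧x⊑x′ }
      where open Bridge β

    bridge-trans : ∀ {x y z} (β : Bridge x y) (γ : Bridge y z) →
                   Bridge.z′ β ⊑ c → Bridge.x′ γ ⊑ c → Bridge x z
    bridge-trans β γ β⊑c γ⊑c = record
      { x′ = B.x′ ; z′ = G.z′ ; x-D-x′ = B.x-D-x′ ; x′-D-z′ = x′Dz′ ; z′-D-z = G.z′-D-z
      ; x′~z′ = ~-trans B.x′~z′ (~-trans meet~meet G.x′~z′)
      ; x′⊑x = B.x′⊑x ; z′⊑z = G.z′⊑z ; c∧x⊑x′ = B.c∧x⊑x′ ; c∧z⊑z′ = G.c∧z⊑z′ }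
      where
        module B = Bridge β
        module G = Bridge γ
        meet~meet : B.z′ ~ G.x′
        meet~meet = ⊑-antisym (⊑-trans (∧-greatest β⊑c B.z′⊑z) G.c∧x⊑x′)
                              (⊑-trans (∧-greatest γ⊑c G.x′⊑x) B.c∧z⊑z′)
        x′Dz′ : Dab B.x′ G.z′
        x′Dz′ = D-trans-within-class
                  (D-trans-within-class B.x′-D-z′
                     (D-trans-at-peak B.z′-D-z G.x-D-x′ B.z′⊑z G.x′⊑x) B.x′~z′ meet~meet)
                  G.x′-D-z′ (~-trans B.x′~z′ meet~meet) G.x′~z′

    bridge-∧ : ∀ {x₁ z₁ x₂ z₂} → Bridge x₁ z₁ → Bridge x₂ z₂ → Bridge (x₁ ∧ x₂) (z₁ ∧ z₂)
    bridge-∧ {x₁} {z₁} {x₂} {z₂} β₁ β₂ = record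
      { x′ = B₁.x′ ∧ B₂.x′ ; z′ = B₁.z′ ∧ B₂.z′
      ; x-D-x′ = D-∧ B₁.x-D-x′ B₂.x-D-x′ ; x′-D-z′ = D-∧ B₁.x′-D-z′ B₂.x′-D-z′
      ; z′-D-z = D-∧ B₁.z′-D-z B₂.z′-D-z ; x′~z′ = ∧-cong B₁.x′~z′ B₂.x′~z′
      ; x′⊑x = ∧-mono-⊑ B₁.x′⊑x B₂.x′⊑x ; z′⊑z = ∧-mono-⊑ B₁.z′⊑z B₂.z′⊑z
      ; c∧x⊑x′ = ⊑-trans (∧-distribˡ-⊑ c x₁ x₂) (∧-mono-⊑ B₁.c∧x⊑x′ B₂.c∧x⊑x′)
      ; c∧z⊑z′ = ⊑-trans (∧-distribˡ-⊑ c z₁ z₂) (∧-mono-⊑ B₁.c∧z⊑z′ B₂.c∧z⊑z′) }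
      where
        module B₁ = Bridge β₁
        module B₂ = Bridge β₂

    bridge-d : ∀ {x₁ z₁ x₂ z₂ x₃ z₃} → Bridge x₁ z₁ → Bridge x₂ z₂ → Bridge x₃ z₃ →
               Bridge (d x₁ x₂ x₃) (d z₁ z₂ z₃)
    bridge-d {x₁} {z₁} {x₂} {z₂} {x₃} {z₃} β₁ β₂ β₃ = record
      { x′ = d B₁.x′ B₂.x′ B₃.x′ ; z′ = d B₁.z′ B₂.z′ B₃.z′
      ; x-D-x′ = D-d B₁.x-D-x′ B₂.x-D-x′ B₃.x-D-x′
      ; x′-D-z′ = D-d B₁.x′-D-z′ B₂.x′-D-z′ B₃.x′-D-z′
      ; z′-D-z = D-d B₁.z′-D-z B₂.z′-D-z B₃.z′-D-z
      ; x′~z′ = d-cong B₁.x′~z′ B₂.x′~z′ B₃.x′~z′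
      ; x′⊑x = d-mono-⊑ B₁.x′⊑x B₂.x′⊑x B₃.x′⊑x
      ; z′⊑z = d-mono-⊑ B₁.z′⊑z B₂.z′⊑z B₃.z′⊑z
      ; c∧x⊑x′ = ⊑-trans (∧-distribˡ-d-⊑ c x₁ x₂ x₃) (d-mono-⊑ B₁.c∧x⊑x′ B₂.c∧x⊑x′ B₃.c∧x⊑x′)
      ; c∧z⊑z′ = ⊑-trans (∧-distribˡ-d-⊑ c z₁ z₂ z₃) (d-mono-⊑ B₁.c∧z⊑z′ B₂.c∧z⊑z′ B₃.c∧z⊑z′) }
      where
        module B₁ = Bridge β₁
        module B₂ = Bridge β₂
        module B₃ = Bridge β₃

    Θ⇒Bridge : ∀ {x z} → Θ x z → Bridge x z
    Θ⇒Bridge (inj₁ refl) = bridge-refl _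
    Θ⇒Bridge (inj₂ ℓ₁) = LowBridge.bridge ℓ₁

    Θ-sym : ∀ {x z} → Θ x z → Θ z x
    Θ-sym (inj₁ refl) = inj₁ refl
    Θ-sym (inj₂ ℓ₁) = inj₂ record
      { bridge = bridge-sym bridge ; x′⊑c = ⊑-trans (~⇒⊑ (~-sym x′~z′)) x′⊑c }
      where open LowBridge ℓ₁

    Θ-trans : ∀ {x y z} → Θ x y → Θ y z → Θ x z
    Θ-trans (inj₁ refl) θ = θ
    Θ-trans (inj₂ ℓ₁) (inj₁ refl) = inj₂ ℓ₁
    Θ-trans (inj₂ ℓ₁) (inj₂ ℓ₂) = inj₂ record
      { bridge = bridge-trans L₁.bridge L₂.bridge (⊑-trans (~⇒⊑ (~-sym L₁.x′~z′)) L₁.x′⊑c) L₂.x′⊑c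
      ; x′⊑c = L₁.x′⊑c }
      where
        module L₁ = LowBridge ℓ₁
        module L₂ = LowBridge ℓ₂

    Θ-∧ : ∀ {x₁ z₁ x₂ z₂} → Θ x₁ z₁ → Θ x₂ z₂ → Θ (x₁ ∧ x₂) (z₁ ∧ z₂)
    Θ-∧ (inj₁ refl) (inj₁ refl) = inj₁ refl
    Θ-∧ (inj₂ ℓ₁) θ₂ = inj₂ record
      { bridge = bridge-∧ (LowBridge.bridge ℓ₁) (Θ⇒Bridge θ₂)
      ; x′⊑c = ⊑-trans (x∧y⊑x _ _) (LowBridge.x′⊑c ℓ₁) }
    Θ-∧ (inj₁ refl) (inj₂ ℓ₂) = inj₂ record
      { bridge = bridge-∧ (bridge-refl _) (LowBridge.bridge ℓ₂)
      ; x′⊑c = ⊑-trans (x∧y⊑y _ _) (LowBridge.x′⊑c ℓ₂) }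

    Θ-d : ∀ {x₁ z₁ x₂ z₂ x₃ z₃} → Θ x₁ z₁ → Θ x₂ z₂ → Θ x₃ z₃ → Θ (d x₁ x₂ x₃) (d z₁ z₂ z₃)
    Θ-d (inj₁ refl) (inj₁ refl) (inj₁ refl) = inj₁ refl
    Θ-d (inj₂ ℓ₁) θ₂ θ₃ = inj₂ record
      { bridge = bridge-d (LowBridge.bridge ℓ₁) (Θ⇒Bridge θ₂) (Θ⇒Bridge θ₃)
      ; x′⊑c = ⊑-trans (d⊑₁ _ _ _) (LowBridge.x′⊑c ℓ₁) }
    Θ-d (inj₁ refl) (inj₂ ℓ₂) θ₃ = inj₂ record
      { bridge = bridge-d (bridge-refl _) (LowBridge.bridge ℓ₂) (Θ⇒Bridge θ₃)
      ; x′⊑c = ⊑-trans (d⊑₂ _ _ _) (LowBridge.x′⊑c ℓ₂) }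
    Θ-d (inj₁ refl) (inj₁ refl) (inj₂ ℓ₃) = inj₂ record
      { bridge = bridge-d (bridge-refl _) (bridge-refl _) (LowBridge.bridge ℓ₃)
      ; x′⊑c = ⊑-trans (d⊑₃ _ _ _) (LowBridge.x′⊑c ℓ₃) }

    Θ-ab : Θ a b
    Θ-ab = inj₂ record
      { bridge = record
        { x′ = b ∧ a ; z′ = a ∧ b
        ; x-D-x′ = subst₂ Dab (∧-idem a) refl (D-∧ D-ab (D-diag a))
        ; x′-D-z′ = D-∧ D-ba D-ab
        ; z′-D-z = subst₂ Dab refl (∧-idem b) (D-∧ D-ab (D-diag b))
        ; x′~z′ = ∧-comm/ b a
        ; x′⊑x = x∧y⊑y b a ; z′⊑z = x∧y⊑y a b
        ; c∧x⊑x′ = ⊑-trans (x∧y⊑x c a) (~⇒⊑ (∧-comm/ a b))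
        ; c∧z⊑z′ = x∧y⊑x c b }
      ; x′⊑c = ~⇒⊑ (∧-comm/ b a) }

    Cg⇒Θ : ∀ {x y} → Cg _∧_ d a b x y → Θ x y
    Cg⇒Θ Cg-base = Θ-ab
    Cg⇒Θ (Cg-refl x) = inj₁ refl
    Cg⇒Θ (Cg-sym p) = Θ-sym (Cg⇒Θ p)
    Cg⇒Θ (Cg-trans p q) = Θ-trans (Cg⇒Θ p) (Cg⇒Θ q)
    Cg⇒Θ (Cg-∧ p q) = Θ-∧ (Cg⇒Θ p) (Cg⇒Θ q)
    Cg⇒Θ (Cg-d p q r) = Θ-d (Cg⇒Θ p) (Cg⇒Θ q) (Cg⇒Θ r)

    Bridge⇒D∘D∘D : ∀ {x y} → Bridge x y → ((Dab ∘ᵣ Dab) ∘ᵣ Dab) x y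
    Bridge⇒D∘D∘D β = z′ , (x′ , x-D-x′ , x′-D-z′) , z′-D-z
      where open Bridge β

    D⇒Cg : ∀ {x y} → Dab x y → Cg _∧_ d a b x y
    D⇒Cg D-ab = Cg-base
    D⇒Cg D-ba = Cg-sym Cg-base
    D⇒Cg (D-diag u) = Cg-refl u
    D⇒Cg (D-∧ p q) = Cg-∧ (D⇒Cg p) (D⇒Cg q)
    D⇒Cg (D-d p q r) = Cg-d (D⇒Cg p) (D⇒Cg q) (D⇒Cg r)

    D∘D∘D⇒Cg : ∀ {x y} → ((Dab ∘ᵣ Dab) ∘ᵣ Dab) x y → Cg _∧_ d a b x y
    D∘D∘D⇒Cg (_ , (_ , p , q) , r) = Cg-trans (Cg-trans (D⇒Cg p) (D⇒Cg q)) (D⇒Cg r)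

    Cg≐D∘D∘D : Cg _∧_ d a b ≐ ((Dab ∘ᵣ Dab) ∘ᵣ Dab)
    Cg≐D∘D∘D x y = (λ p → Bridge⇒D∘D∘D (Θ⇒Bridge (Cg⇒Θ p))) , D∘D∘D⇒Cg

theorem6p3 : (n : ℕ) (_∧_ : Fin n → Fin n → Fin n) (d : Fin n → Fin n → Fin n → Fin n)
    → IsRegularSMB _∧_ d
    → (a b : Fin n)
    → Cg _∧_ d a b ≐ ((D _∧_ d a b ∘ᵣ D _∧_ d a b) ∘ᵣ D _∧_ d a b)
theorem6p3 _ _∧_ d (_ , R) a b = Cg≐D∘D∘D
  where open RegularSMB.Generated R a b
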